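{- Let $q$ be a power of a prime $p$, let $z\in\mathbb{F}_q^*$, and assume that $x^2+x-z$ has two distinct roots in $\mathbb{F}_q$. Then, in $\mathbb{F}_q$, \[ \sum_{0\le k\le (q-1)/2}\binom{ -k}{k+1} z^k=1. \]
   Context: For an integer $m$ and integer $a\ge 0$, $\binom{m}{a}=m(m-1)\cdots(m-a+1)/a!\in\mathbb{Z}$ (generalized binomial coefficient), regarded as an element of $\mathbb{F}_p\subseteq\mathbb{F}_q$ by reduction modulo $p$. -}

module Defs where

open import Level using (Level)
open import Algebra.Bundles using (CommutativeRing)
open import Data.Nat as ℕ using (ℕ; zero; suc; _!)
open import Data.Nat.Properties using (_!≢0)
open import Data.Integer as ℤ using (ℤ; +_; -[1+_]; _/ℕ_)
open import Data.Fin using (Fin)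
open import Data.Product using (Σ; _×_)
open import Function.Bundles using (Inverse)
open import Relation.Nullary using (¬_)
import Relation.Binary.PropositionalEquality as P

fallingℤ : ℤ → ℕ → ℤ
fallingℤ m zero    = + 1
fallingℤ m (suc a) = fallingℤ m a ℤ.* (m ℤ.- + a)

binomℤ : ℤ → ℕ → ℤ
binomℤ m a = (fallingℤ m a /ℕ (a !)) {{a !≢0}}

module _ {c ℓ : Level} (R : CommutativeRing c ℓ) where
  open CommutativeRing R

  record IsFiniteField (q : ℕ) : Set (c Level.⊔ ℓ) where
    field
      nontrivial : ¬ (1# ≈ 0#)
      inverse    : ∀ x → ¬ (x ≈ 0#) → Σ Carrier (λ y → x * y ≈ 1#)
      card       : Inverse setoid (P.setoid (Fin q))

  natCast : ℕ → Carrier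
  natCast zero    = 0#
  natCast (suc n) = 1# + natCast n

  intCast : ℤ → Carrier
  intCast (+ n)     = natCast n
  intCast -[1+ n ]  = - natCast (suc n)

  pow : Carrier → ℕ → Carrier
  pow x zero    = 1#
  pow x (suc n) = pow x n * x

  sumUpTo : ℕ → (ℕ → Carrier) → Carrier
  sumUpTo zero    f = f 0
  sumUpTo (suc N) f = sumUpTo N f + f (suc N)

-- Put F_m = Σ_{j ≤ m} C(m-j, j) z^j and G_m = Σ_{j ≤ m} C(m-j, j+1) z^j. Then F_{m+1} = 1 + z G_m,
-- and Pascal's rule gives the Fibonacci-type recurrence F_{m+2} = F_{m+1} + z F_m. The negatives
-- α, β of the two given roots are distinct roots of x² = x + z, so Binet's formula
-- (α - β) F_m = α^(m+1) - β^(m+1) holds; with α^q = α and β^q = β it gives F_{q+1} = F_2, hence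
-- G_q = G_1 = 1. Finally the sum in question is G_q: for 0 < j < q the prime p divides C(q, j)
-- (since j C(q, j) = q C(q-1, j-1)), so Pascal's rule shows C(q-1-k, j) ≡ (-1)^j C(j+k, j) = C(-1-k, j)
-- in characteristic p, whence C(-k, k+1) ≡ C(q-k, k+1); and these terms vanish for k > (q-1)/2.
module Submission where

open import Defs
open import Level using (Level)
open import Algebra.Bundles using (CommutativeRing)
open import Data.Nat as ℕ using (ℕ; zero; suc; z≤n; s≤s; _^_; _∸_; _/_; NonZero)
open import Data.Nat.Primality using (Prime)
open import Data.Integer as ℤ using (ℤ; +_; -[1+_]; -1ℤ; _⊖_) renaming (-_ to negℤ)
import Data.Integer.Properties as ℤ
import Data.Nat.Properties as ℕ
open import Data.Nat.DivMod using (m/n≤m)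
open import Data.Product using (Σ-syntax; _×_; _,_; proj₁; proj₂)
open import Relation.Nullary using (¬_; yes; no)
open import Data.Empty using (⊥-elim)
open import Data.Sum using (_⊎_; inj₁; inj₂)
open import Data.Maybe using (Maybe; just; nothing)
open import Data.Nat.Combinatorics using (_C_; nCk+nC[k+1]≡[n+1]C[k+1]; nCn≡1; nC1≡n; k>n⇒nCk≡0)
open import Data.Nat.Divisibility using (_∣_; _∣?_; divides; ∣-trans; m∣m*n; *-monoʳ-∣; *-cancelˡ-∣; ∣⇒≤)
import Data.Fin as Fin
import Data.Fin.Properties as Fin
import Data.Fin.Permutation as Perm
open Perm using (_⟨$⟩ʳ_)
open import Function using (_∘_)
open import Function.Bundles using (Inverse)
open import Relation.Binary.Definitions using (Decidable)
import Relation.Binary.PropositionalEquality as ≡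
open ≡ using (_≡_)
open import Algebra.Solver.Ring.AlmostCommutativeRing using (_-Raw-AlmostCommutative⟶_; fromCommutativeRing)
import Algebra.Solver.Ring
import Algebra.Properties.CommutativeMonoid.Sum as Sum

module _ where
  open import Data.Nat using (_+_; _*_; _≤_; _<_)
  open import Data.Nat.Properties
  open import Data.Nat.DivMod using (m/n*n≤m; m*n/n≡m; /-monoˡ-≤)
  open import Data.Nat.Primality using (euclidsLemma; prime⇒nonZero)
  open ≡

  [1+k]*[1+n]C[1+k]≡[1+n]*nCk : ∀ n k → suc k * (suc n C suc k) ≡ suc n * (n C k)
  [1+k]*[1+n]C[1+k]≡[1+n]*nCk zero    zero    = refl
  [1+k]*[1+n]C[1+k]≡[1+n]*nCk zero    (suc k) = *-zeroʳ (suc (suc k))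
  [1+k]*[1+n]C[1+k]≡[1+n]*nCk (suc n) zero    =
    trans (+-identityʳ _) (trans (nC1≡n (suc (suc n))) (sym (*-identityʳ (suc (suc n)))))
  [1+k]*[1+n]C[1+k]≡[1+n]*nCk (suc n) (suc k) = begin
    suc (suc k) * (suc (suc n) C suc (suc k))
      ≡⟨ cong (suc (suc k) *_) (nCk+nC[k+1]≡[n+1]C[k+1] (suc n) (suc k)) ⟨
    suc (suc k) * (X + Y)
      ≡⟨ *-distribˡ-+ (suc (suc k)) X Y ⟩
    X + suc k * X + suc (suc k) * Y
      ≡⟨ cong₂ (λ u v → X + u + v) ([1+k]*[1+n]C[1+k]≡[1+n]*nCk n k) ([1+k]*[1+n]C[1+k]≡[1+n]*nCk n (suc k)) ⟩
    X + suc n * (n C k) + suc n * (n C suc k)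
      ≡⟨ +-assoc X _ _ ⟩
    X + (suc n * (n C k) + suc n * (n C suc k))
      ≡⟨ cong (λ w → X + w) (*-distribˡ-+ (suc n) (n C k) (n C suc k)) ⟨
    X + suc n * (n C k + n C suc k)
      ≡⟨ cong (λ w → X + suc n * w) (nCk+nC[k+1]≡[n+1]C[k+1] n k) ⟩
    suc (suc n) * X ∎
    where
    open ≡-Reasoning
    X Y : ℕ
    X = suc n C suc k
    Y = suc n C suc (suc k)

  n∣[1+k]*nC[1+k] : ∀ n k → n ∣ suc k * (n C suc k)
  n∣[1+k]*nC[1+k] zero    k = divides 0 (*-zeroʳ (suc k))
  n∣[1+k]*nC[1+k] (suc n) k =
    divides (n C k) (trans ([1+k]*[1+n]C[1+k]≡[1+n]*nCk n k) (*-comm (suc n) (n C k)))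

  p^e∣m*n⇒p∤n⇒p^e∣m : ∀ {p} → Prime p → ∀ e {m n} → p ^ e ∣ m * n → ¬ p ∣ n → p ^ e ∣ m
  p^e∣m*n⇒p∤n⇒p^e∣m p-prime zero    {m} _ _ = divides m (sym (*-identityʳ m))
  p^e∣m*n⇒p∤n⇒p^e∣m {p} p-prime (suc e) {m} {n} p^[1+e]∣mn p∤n
    with euclidsLemma m n p-prime (∣-trans (m∣m*n (p ^ e)) p^[1+e]∣mn)
  ... | inj₂ p∣n = ⊥-elim (p∤n p∣n)
  ... | inj₁ (divides k refl) =
    subst (p * p ^ e ∣_) (*-comm p k) (*-monoʳ-∣ p (p^e∣m*n⇒p∤n⇒p^e∣m p-prime e p^e∣kn p∤n))
    where
    instance _ = prime⇒nonZero p-prime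
    p^e∣kn : p ^ e ∣ k * n
    p^e∣kn = *-cancelˡ-∣ p (subst (p * p ^ e ∣_) (trans (cong (_* n) (*-comm k p)) (*-assoc p k n)) p^[1+e]∣mn)

  p∣p^mCj : ∀ {p} → Prime p → ∀ m {j} → 0 < j → j < p ^ m → p ∣ p ^ m C j
  p∣p^mCj {p} p-prime m {suc k} _ j<p^m with p ∣? p ^ m C suc k
  ... | yes p∣C = p∣C
  ... | no  p∤C =
    ⊥-elim (<⇒≱ j<p^m (∣⇒≤ (p^e∣m*n⇒p∤n⇒p^e∣m p-prime m (n∣[1+k]*nC[1+k] (p ^ m) k) p∤C)))

  [1+m∸j]C[1+j]≡[m∸j]Cj+[m∸j]C[1+j] : ∀ m j → (suc m ∸ j) C suc j ≡ (m ∸ j) C j + (m ∸ j) C suc j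
  [1+m∸j]C[1+j]≡[m∸j]Cj+[m∸j]C[1+j] m j with ≤-<-connex j m
  ... | inj₁ j≤m rewrite +-∸-assoc 1 j≤m = sym (nCk+nC[k+1]≡[n+1]C[k+1] (m ∸ j) j)
  ... | inj₂ m<j@(s≤s _) rewrite m≤n⇒m∸n≡0 m<j | m≤n⇒m∸n≡0 (<⇒≤ m<j) = refl

  [m∸k]C[1+j]≡0 : ∀ {m k} j → m ≤ k → (m ∸ k) C suc j ≡ 0
  [m∸k]C[1+j]≡0 j m≤k rewrite m≤n⇒m∸n≡0 m≤k = refl

  k≤m/2⇒k<m : ∀ {m k} → 0 < m → k ≤ m / 2 → k < m
  k≤m/2⇒k<m {m} {zero}  0<m _      = 0<m
  k≤m/2⇒k<m {m} {suc k} _   k≤m/2 =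
    ≤-trans (s≤s (s≤s (m≤m*n k 2))) (≤-trans (*-monoˡ-≤ 2 k≤m/2) (m/n*n≤m m 2))

  m/2<k⇒m<k+k : ∀ {m k} → m / 2 < k → m < k + k
  m/2<k⇒m<k+k {m} {k} m/2<k = ≰⇒> λ k+k≤m → <⇒≱ m/2<k (begin
    k                 ≡⟨ m*n/n≡m k 2 ⟨
    k * 2 / 2         ≡⟨ cong (_/ 2) (*-comm k 2) ⟩
    (k + (k + 0)) / 2 ≡⟨ cong (λ n → (k + n) / 2) (+-identityʳ k) ⟩
    (k + k) / 2       ≤⟨ /-monoˡ-≤ 2 k+k≤m ⟩
    m / 2             ∎)
    where open ≤-Reasoning

module _ where
  open import Data.Nat using (_!)
  open import Data.Nat.Properties using (_!≢0; m*n≡0⇒m≡0; 0≢1+n)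
  open import Data.Nat.DivMod using (_%_; 0/n≡0; m*n/n≡m; m*n%n≡0)
  open import Data.Integer using (_*_; _-_; -_; _/ℕ_; 1ℤ)
  open import Data.Integer.Properties using (neg-minus-pos; pos-*; -1*i≡-i; *-identityˡ)
  open import Data.Integer.Tactic.RingSolver using (solve-∀)
  import Data.Nat.Tactic.RingSolver as ℕ-Solver
  open ≡

  -1^n≡1∨-1 : ∀ n → -1ℤ ℤ.^ n ≡ 1ℤ ⊎ -1ℤ ℤ.^ n ≡ -1ℤ
  -1^n≡1∨-1 zero    = inj₁ refl
  -1^n≡1∨-1 (suc n) with -1^n≡1∨-1 n
  ... | inj₁ eq = inj₂ (cong (-1ℤ *_) eq)
  ... | inj₂ eq = inj₁ (cong (-1ℤ *_) eq)

  -[m*n]/ℕn≡-m : ∀ m n .{{_ : NonZero n}} → (- + (m ℕ.* n)) /ℕ n ≡ - + m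
  -[m*n]/ℕn≡-m m n with m ℕ.* n in mn≡
  ... | zero rewrite m*n≡0⇒m≡0 m n mn≡ = cong +_ (0/n≡0 n)
  ... | suc k with suc k % n in remainder
  ...   | zero  = cong (λ w → - + w) (trans (cong (_/ n) (sym mn≡)) (m*n/n≡m m n))
  ...   | suc _ = ⊥-elim (0≢1+n (trans (sym (m*n%n≡0 m n)) (trans (cong (_% n) mn≡) remainder)))

  -1^s*[m*n]/ℕn≡-1^s*m : ∀ s m n .{{_ : NonZero n}} → (-1ℤ ℤ.^ s * + (m ℕ.* n)) /ℕ n ≡ -1ℤ ℤ.^ s * + m
  -1^s*[m*n]/ℕn≡-1^s*m s m n with -1^n≡1∨-1 s
  ... | inj₁ eq rewrite eq | *-identityˡ (+ (m ℕ.* n)) | *-identityˡ (+ m) = cong +_ (m*n/n≡m m n)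
  ... | inj₂ eq rewrite eq | -1*i≡-i (+ (m ℕ.* n)) | -1*i≡-i (+ m) = -[m*n]/ℕn≡-m m n

  fallingℤ-negsuc : ∀ n a → fallingℤ -[1+ n ] a ≡ -1ℤ ℤ.^ a * + (((a ℕ.+ n) C a) ℕ.* a !)
  fallingℤ-negsuc n zero    = refl
  fallingℤ-negsuc n (suc a) = begin
    fallingℤ -[1+ n ] a * (-[1+ n ] - + a)
      ≡⟨ cong₂ _*_ (fallingℤ-negsuc n a) (neg-minus-pos n a) ⟩
    -1ℤ ℤ.^ a * + (X ℕ.* a !) * - + suc (a ℕ.+ n)
      ≡⟨ sign-step (-1ℤ ℤ.^ a) _ _ ⟩
    -1ℤ ℤ.^ suc a * (+ (X ℕ.* a !) * + suc (a ℕ.+ n))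
      ≡⟨ cong (-1ℤ ℤ.^ suc a *_) (pos-* (X ℕ.* a !) (suc (a ℕ.+ n))) ⟨
    -1ℤ ℤ.^ suc a * + (X ℕ.* a ! ℕ.* suc (a ℕ.+ n))
      ≡⟨ cong (λ w → -1ℤ ℤ.^ suc a * + w) absorbed ⟩
    -1ℤ ℤ.^ suc a * + (((suc a ℕ.+ n) C suc a) ℕ.* (suc a) !) ∎
    where
    open ≡-Reasoning
    X : ℕ
    X = (a ℕ.+ n) C a
    sign-step : ∀ s x y → s * x * - y ≡ (-1ℤ * s) * (x * y)
    sign-step = solve-∀
    absorbed : X ℕ.* a ! ℕ.* suc (a ℕ.+ n) ≡ ((suc a ℕ.+ n) C suc a) ℕ.* (suc a) !
    absorbed = begin
      X ℕ.* a ! ℕ.* suc (a ℕ.+ n)                  ≡⟨ rotate X (a !) (suc (a ℕ.+ n)) ⟩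
      suc (a ℕ.+ n) ℕ.* X ℕ.* a !                  ≡⟨ cong (ℕ._* a !) ([1+k]*[1+n]C[1+k]≡[1+n]*nCk (a ℕ.+ n) a) ⟨
      suc a ℕ.* ((suc a ℕ.+ n) C suc a) ℕ.* a !    ≡⟨ swap (suc a) ((suc a ℕ.+ n) C suc a) (a !) ⟩
      ((suc a ℕ.+ n) C suc a) ℕ.* (suc a) !        ∎
      where
      rotate : ∀ x y z → x ℕ.* y ℕ.* z ≡ z ℕ.* x ℕ.* y
      rotate = ℕ-Solver.solve-∀
      swap : ∀ x y z → x ℕ.* y ℕ.* z ≡ y ℕ.* (x ℕ.* z)
      swap = ℕ-Solver.solve-∀

  binomℤ-negsuc : ∀ n a → binomℤ -[1+ n ] a ≡ -1ℤ ℤ.^ a * + ((a ℕ.+ n) C a)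
  binomℤ-negsuc n a = trans (cong (λ w → (w /ℕ a !) {{a !≢0}}) (fallingℤ-negsuc n a))
                            (-1^s*[m*n]/ℕn≡-1^s*m a _ (a !) {{a !≢0}})

module _ {c ℓ : Level} (R : CommutativeRing c ℓ) where
  open CommutativeRing R
  open import Algebra.Properties.Monoid.Mult +-monoid using (×-homo-+) renaming (_×_ to _·_)
  open import Algebra.Properties.Semiring.Mult semiring using (×1-homo-*)
  open import Algebra.Properties.Group +-group
    using (x≈z//y; ∙-cancelˡ; x∙y⁻¹≈ε⇒x≈y; //-rightDividesˡ; //-rightDividesʳ; ⁻¹-involutive; ε⁻¹≈ε)
  open import Algebra.Properties.AbelianGroup +-abelianGroup using (⁻¹-∙-comm)
  open import Algebra.Properties.Ring ring using (-‿distribˡ-*; -‿distribʳ-*)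
  open import Algebra.Properties.CommutativeSemigroup +-commutativeSemigroup using (x∙yz≈y∙xz; interchange)
  open import Algebra.Properties.CommutativeSemigroup *-commutativeSemigroup using (xy∙z≈y∙xz)
  open import Relation.Binary.Reasoning.Setoid setoid

  natCast≈·1 : ∀ n → natCast R n ≈ n · 1#
  natCast≈·1 zero    = refl
  natCast≈·1 (suc n) = +-congˡ (natCast≈·1 n)

  natCast-+ : ∀ m n → natCast R (m ℕ.+ n) ≈ natCast R m + natCast R n
  natCast-+ m n = begin
    natCast R (m ℕ.+ n)    ≈⟨ natCast≈·1 (m ℕ.+ n) ⟩
    (m ℕ.+ n) · 1#         ≈⟨ ×-homo-+ 1# m n ⟩
    m · 1# + n · 1#        ≈⟨ +-cong (natCast≈·1 m) (natCast≈·1 n) ⟨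
    natCast R m + natCast R n ∎

  natCast-* : ∀ m n → natCast R (m ℕ.* n) ≈ natCast R m * natCast R n
  natCast-* m n = begin
    natCast R (m ℕ.* n)    ≈⟨ natCast≈·1 (m ℕ.* n) ⟩
    (m ℕ.* n) · 1#         ≈⟨ ×1-homo-* m n ⟩
    m · 1# * n · 1#        ≈⟨ *-cong (natCast≈·1 m) (natCast≈·1 n) ⟨
    natCast R m * natCast R n ∎

  intCast-neg : ∀ i → intCast R (negℤ i) ≈ - intCast R i
  intCast-neg (+ zero)  = sym ε⁻¹≈ε
  intCast-neg (+ suc n) = refl
  intCast-neg -[1+ n ]  = sym (⁻¹-involutive _)

  intCast[m⊖n]+n≈m : ∀ m n → intCast R (m ⊖ n) + natCast R n ≈ natCast R m
  intCast[m⊖n]+n≈m m       zero    = +-identityʳ _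
  intCast[m⊖n]+n≈m zero    (suc n) = -‿inverseˡ _
  intCast[m⊖n]+n≈m (suc m) (suc n) = begin
    intCast R (suc m ⊖ suc n) + (1# + natCast R n)
      ≡⟨ ≡.cong (λ i → intCast R i + (1# + natCast R n)) (ℤ.[1+m]⊖[1+n]≡m⊖n m n) ⟩
    intCast R (m ⊖ n) + (1# + natCast R n)  ≈⟨ x∙yz≈y∙xz _ 1# _ ⟩
    1# + (intCast R (m ⊖ n) + natCast R n)  ≈⟨ +-congˡ (intCast[m⊖n]+n≈m m n) ⟩
    1# + natCast R m ∎

  intCast-⊖ : ∀ m n → intCast R (m ⊖ n) ≈ natCast R m - natCast R n
  intCast-⊖ m n = x≈z//y _ _ _ (intCast[m⊖n]+n≈m m n)

  intCast-+ : ∀ i j → intCast R (i ℤ.+ j) ≈ intCast R i + intCast R j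
  intCast-+ (+ m)    (+ n)    = natCast-+ m n
  intCast-+ (+ m)    -[1+ n ] = intCast-⊖ m (suc n)
  intCast-+ -[1+ m ] (+ n)    = trans (intCast-⊖ n (suc m)) (+-comm _ _)
  intCast-+ -[1+ m ] -[1+ n ] = begin
    - natCast R (suc (suc (m ℕ.+ n)))     ≡⟨ ≡.cong (λ k → - natCast R (suc k)) (ℕ.+-suc m n) ⟨
    - natCast R (suc m ℕ.+ suc n)         ≈⟨ -‿cong (natCast-+ (suc m) (suc n)) ⟩
    - (natCast R (suc m) + natCast R (suc n)) ≈⟨ ⁻¹-∙-comm _ _ ⟨
    - natCast R (suc m) + - natCast R (suc n) ∎

  intCast-pos-* : ∀ m j → intCast R (+ m ℤ.* j) ≈ natCast R m * intCast R j
  intCast-pos-* m (+ n)    = ≡.subst (λ i → intCast R i ≈ natCast R m * natCast R n) (ℤ.pos-* m n) (natCast-* m n)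
  intCast-pos-* m -[1+ n ] = begin
    intCast R (+ m ℤ.* -[1+ n ])               ≡⟨ ≡.cong (intCast R) (ℤ.neg-distribʳ-* (+ m) (+ suc n)) ⟨
    intCast R (negℤ (+ m ℤ.* + suc n))          ≈⟨ intCast-neg (+ m ℤ.* + suc n) ⟩
    - intCast R (+ m ℤ.* + suc n)              ≈⟨ -‿cong (intCast-pos-* m (+ suc n)) ⟩
    - (natCast R m * natCast R (suc n))        ≈⟨ -‿distribʳ-* _ _ ⟩
    natCast R m * - natCast R (suc n) ∎

  intCast-* : ∀ i j → intCast R (i ℤ.* j) ≈ intCast R i * intCast R j
  intCast-* (+ m)    j = intCast-pos-* m j
  intCast-* -[1+ m ] j = begin
    intCast R (-[1+ m ] ℤ.* j)                 ≡⟨ ≡.cong (intCast R) (ℤ.neg-distribˡ-* (+ suc m) j) ⟨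
    intCast R (negℤ (+ suc m ℤ.* j))            ≈⟨ intCast-neg (+ suc m ℤ.* j) ⟩
    - intCast R (+ suc m ℤ.* j)                ≈⟨ -‿cong (intCast-pos-* (suc m) j) ⟩
    - (natCast R (suc m) * intCast R j)        ≈⟨ -‿distribˡ-* _ _ ⟩
    - natCast R (suc m) * intCast R j ∎

  intCast-morphism : ℤ.+-*-rawRing -Raw-AlmostCommutative⟶ fromCommutativeRing R
  intCast-morphism = record
    { ⟦_⟧    = intCast R
    ; +-homo = intCast-+
    ; *-homo = intCast-*
    ; -‿homo = intCast-neg
    ; 0-homo = refl
    ; 1-homo = +-identityʳ 1#
    }

  intCast-≟ : ∀ i j → Maybe (intCast R i ≈ intCast R j)
  intCast-≟ i j with i ℤ.≟ j
  ... | yes ≡.refl = just refl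
  ... | no  _      = nothing

  -- A solver constant `con c` evaluates to `intCast R c` (e.g. `1# + 0#`, not `1#`), so the
  -- identities handed to the solver below mention no constants.
  open Algebra.Solver.Ring ℤ.+-*-rawRing (fromCommutativeRing R) intCast-morphism intCast-≟
    using (solve; _:=_; _:+_; _:-_; _:*_; :-_)

  sumUpTo-cong : ∀ N {f g} → (∀ j → j ℕ.≤ N → f j ≈ g j) → sumUpTo R N f ≈ sumUpTo R N g
  sumUpTo-cong zero    f≈g = f≈g 0 z≤n
  sumUpTo-cong (suc N) f≈g =
    +-cong (sumUpTo-cong N (λ j j≤N → f≈g j (ℕ.m≤n⇒m≤1+n j≤N))) (f≈g (suc N) ℕ.≤-refl)

  sumUpTo-+ : ∀ N f g → sumUpTo R N (λ j → f j + g j) ≈ sumUpTo R N f + sumUpTo R N g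
  sumUpTo-+ zero    f g = refl
  sumUpTo-+ (suc N) f g = trans (+-congʳ (sumUpTo-+ N f g)) (interchange _ _ _ _)

  sumUpTo-*ˡ : ∀ N x f → sumUpTo R N (λ j → x * f j) ≈ x * sumUpTo R N f
  sumUpTo-*ˡ zero    x f = refl
  sumUpTo-*ˡ (suc N) x f = trans (+-congʳ (sumUpTo-*ˡ N x f)) (sym (distribˡ x _ _))

  sumUpTo-suc : ∀ N f → sumUpTo R (suc N) f ≈ f 0 + sumUpTo R N (λ j → f (suc j))
  sumUpTo-suc zero    f = refl
  sumUpTo-suc (suc N) f = trans (+-congʳ (sumUpTo-suc N f)) (+-assoc _ _ _)

  sumUpTo-vanishing : ∀ {N M f} → N ℕ.≤′ M → (∀ k → N ℕ.< k → f k ≈ 0#) →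
                      sumUpTo R M f ≈ sumUpTo R N f
  sumUpTo-vanishing ℕ.≤′-refl         _      = refl
  sumUpTo-vanishing (ℕ.≤′-step N≤′M) vanish =
    trans (+-congˡ (vanish _ (s≤s (ℕ.≤′⇒≤ N≤′M))))
          (trans (+-identityʳ _) (sumUpTo-vanishing N≤′M vanish))

  module _ (z : Carrier) where

    Recurrent : (ℕ → Carrier) → Set ℓ
    Recurrent u = ∀ m → u (suc (suc m)) ≈ u (suc m) + z * u m

    recurrent-unique : ∀ {u v} → Recurrent u → Recurrent v → u 0 ≈ v 0 → u 1 ≈ v 1 → ∀ m → u m ≈ v m
    recurrent-unique {u} {v} rec-u rec-v u₀≈v₀ u₁≈v₁ m = proj₁ (agree m)
      where
      agree : ∀ m → u m ≈ v m × u (suc m) ≈ v (suc m)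
      agree zero    = u₀≈v₀ , u₁≈v₁
      agree (suc m) = let (uₘ≈vₘ , uₘ₊₁≈vₘ₊₁) = agree m in
        uₘ₊₁≈vₘ₊₁ , trans (rec-u m) (trans (+-cong uₘ₊₁≈vₘ₊₁ (*-congˡ uₘ≈vₘ)) (sym (rec-v m)))

    recurrent-*ˡ : ∀ x {u} → Recurrent u → Recurrent (λ m → x * u m)
    recurrent-*ˡ x rec-u m = trans (*-congˡ (rec-u m)) (distrib-swap x _ _)
      where
      distrib-swap : ∀ x a b → x * (a + z * b) ≈ x * a + z * (x * b)
      distrib-swap x a b = solve 4 (λ x a b z → x :* (a :+ z :* b) := x :* a :+ z :* (x :* b)) refl x a b z

    recurrent-- : ∀ {u v} → Recurrent u → Recurrent v → Recurrent (λ m → u m - v m)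
    recurrent-- {u} {v} rec-u rec-v m =
      trans (+-cong (rec-u m) (-‿cong (rec-v m))) (sub-distrib (u (suc m)) (v (suc m)) (u m) (v m) z)
      where
      sub-distrib : ∀ a b c d z → (a + z * c) - (b + z * d) ≈ (a - b) + z * (c - d)
      sub-distrib = solve 5 (λ a b c d z → (a :+ z :* c) :- (b :+ z :* d) := (a :- b) :+ z :* (c :- d)) refl

    pow-recurrent : ∀ {α} → α * α ≈ α + z → Recurrent (λ m → pow R α (suc m))
    pow-recurrent {α} α²≈α+z m = begin
      αᵐ⁺¹ * α * α      ≈⟨ *-assoc αᵐ⁺¹ α α ⟩
      αᵐ⁺¹ * (α * α)    ≈⟨ *-congˡ α²≈α+z ⟩
      αᵐ⁺¹ * (α + z)    ≈⟨ distribˡ αᵐ⁺¹ α z ⟩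
      αᵐ⁺¹ * α + αᵐ⁺¹ * z ≈⟨ +-congˡ (*-comm αᵐ⁺¹ z) ⟩
      αᵐ⁺¹ * α + z * αᵐ⁺¹ ∎
      where
      αᵐ⁺¹ : Carrier
      αᵐ⁺¹ = pow R α (suc m)

    fib : ℕ → Carrier
    fib m = sumUpTo R m (λ j → natCast R ((m ∸ j) C j) * pow R z j)

    fib′ : ℕ → Carrier
    fib′ m = sumUpTo R m (λ j → natCast R ((m ∸ j) C suc j) * pow R z j)

    fib-suc : ∀ m → fib (suc m) ≈ 1# + z * fib′ m
    fib-suc m = begin
      fib (suc m)
        ≈⟨ sumUpTo-suc m _ ⟩
      (1# + 0#) * 1# + sumUpTo R m (λ j → natCast R ((m ∸ j) C suc j) * (pow R z j * z))
        ≈⟨ +-cong (trans (*-identityʳ _) (+-identityʳ 1#)) (sumUpTo-cong m (λ j _ → shuffle _ _)) ⟩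
      1# + sumUpTo R m (λ j → z * (natCast R ((m ∸ j) C suc j) * pow R z j))
        ≈⟨ +-congˡ (sumUpTo-*ˡ m z _) ⟩
      1# + z * fib′ m ∎
      where
      shuffle : ∀ c p → c * (p * z) ≈ z * (c * p)
      shuffle c p = solve 3 (λ c p z → c :* (p :* z) := z :* (c :* p)) refl c p z

    fib′-suc : ∀ m → fib′ (suc m) ≈ fib m + fib′ m
    fib′-suc m = begin
      fib′ (suc m)
        ≈⟨ sumUpTo-cong (suc m) (λ j _ → pascal j) ⟩
      sumUpTo R (suc m) (λ j → f j + g j)
        ≈⟨ sumUpTo-+ (suc m) f g ⟩
      sumUpTo R (suc m) f + sumUpTo R (suc m) g
        ≈⟨ +-cong (sumUpTo-vanishing step (λ { (suc k) m<k → beyond k _ (ℕ.<⇒≤ m<k) }))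
                  (sumUpTo-vanishing step (λ k m<k → beyond k _ (ℕ.<⇒≤ m<k))) ⟩
      fib m + fib′ m ∎
      where
      f g : ℕ → Carrier
      f j = natCast R ((m ∸ j) C j) * pow R z j
      g j = natCast R ((m ∸ j) C suc j) * pow R z j
      step : m ℕ.≤′ suc m
      step = ℕ.≤′-step ℕ.≤′-refl
      pascal : ∀ j → natCast R ((suc m ∸ j) C suc j) * pow R z j ≈ f j + g j
      pascal j = trans (*-congʳ (trans (reflexive (≡.cong (natCast R) ([1+m∸j]C[1+j]≡[m∸j]Cj+[m∸j]C[1+j] m j)))
                                       (natCast-+ ((m ∸ j) C j) ((m ∸ j) C suc j))))
                       (distribʳ _ _ _)
      beyond : ∀ {k} j x → m ℕ.≤ k → natCast R ((m ∸ k) C suc j) * x ≈ 0#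
      beyond j x m≤k = trans (*-congʳ (reflexive (≡.cong (natCast R) ([m∸k]C[1+j]≡0 j m≤k)))) (zeroˡ x)

    fib-recurrent : Recurrent fib
    fib-recurrent m = begin
      fib (suc (suc m))              ≈⟨ fib-suc (suc m) ⟩
      1# + z * fib′ (suc m)          ≈⟨ +-congˡ (*-congˡ (fib′-suc m)) ⟩
      1# + z * (fib m + fib′ m)      ≈⟨ regroup 1# (fib m) (fib′ m) z ⟩
      (1# + z * fib′ m) + z * fib m  ≈⟨ +-congʳ (fib-suc m) ⟨
      fib (suc m) + z * fib m ∎
      where
      regroup : ∀ o a b z → o + z * (a + b) ≈ (o + z * b) + z * a
      regroup = solve 4 (λ o a b z → o :+ z :* (a :+ b) := (o :+ z :* b) :+ z :* a) refl

    fib-zero : fib 0 ≈ 1#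
    fib-zero = trans (*-identityʳ _) (+-identityʳ 1#)

    fib-one : fib 1 ≈ 1#
    fib-one = trans (fib-suc 0) (trans (+-congˡ (trans (*-congˡ (zeroˡ 1#)) (zeroʳ z))) (+-identityʳ 1#))

    fib′-one : fib′ 1 ≈ 1#
    fib′-one = trans (+-cong (trans (*-identityʳ _) (+-identityʳ 1#)) (zeroˡ _)) (+-identityʳ 1#)

    fib-binet : ∀ {α β} → α * α ≈ α + z → β * β ≈ β + z →
                ∀ m → (α - β) * fib m ≈ pow R α (suc m) - pow R β (suc m)
    fib-binet {α} {β} α²≈α+z β²≈β+z = recurrent-unique
      (recurrent-*ˡ (α - β) fib-recurrent)
      (recurrent-- (pow-recurrent α²≈α+z) (pow-recurrent β²≈β+z))
      (begin
        (α - β) * fib 0        ≈⟨ trans (*-congˡ fib-zero) (*-identityʳ _) ⟩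
        α - β                  ≈⟨ +-cong (*-identityˡ α) (-‿cong (*-identityˡ β)) ⟨
        1# * α - 1# * β ∎)
      (begin
        (α - β) * fib 1        ≈⟨ trans (*-congˡ fib-one) (*-identityʳ _) ⟩
        α - β                  ≈⟨ shift α β z ⟩
        (α + z) - (β + z)      ≈⟨ +-cong α²≈α+z (-‿cong β²≈β+z) ⟨
        α * α - β * β          ≈⟨ +-cong (*-congʳ (*-identityˡ α)) (-‿cong (*-congʳ (*-identityˡ β))) ⟨
        1# * α * α - 1# * β * β ∎)
      where
      shift : ∀ a b z → a - b ≈ (a + z) - (b + z)
      shift = solve 3 (λ a b z → a :- b := (a :+ z) :- (b :+ z)) refl

  pow-[-1]-suc : ∀ j → pow R (- 1#) (suc j) ≈ - pow R (- 1#) j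
  pow-[-1]-suc j = trans (sym (-‿distribʳ-* _ 1#)) (-‿cong (*-identityʳ _))

  intCast-[-1]^ : ∀ a → intCast R (-1ℤ ℤ.^ a) ≈ pow R (- 1#) a
  intCast-[-1]^ zero    = +-identityʳ 1#
  intCast-[-1]^ (suc a) = begin
    intCast R (-1ℤ ℤ.* -1ℤ ℤ.^ a)          ≈⟨ intCast-* -1ℤ (-1ℤ ℤ.^ a) ⟩
    - (1# + 0#) * intCast R (-1ℤ ℤ.^ a)      ≈⟨ *-cong (-‿cong (+-identityʳ 1#)) (intCast-[-1]^ a) ⟩
    - 1# * pow R (- 1#) a                      ≈⟨ *-comm _ _ ⟩
    pow R (- 1#) a * - 1# ∎

  intCast-binomℤ-negsuc : ∀ n a → intCast R (binomℤ -[1+ n ] a) ≈ pow R (- 1#) a * natCast R ((a ℕ.+ n) C a)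
  intCast-binomℤ-negsuc n a = begin
    intCast R (binomℤ -[1+ n ] a)                         ≡⟨ ≡.cong (intCast R) (binomℤ-negsuc n a) ⟩
    intCast R (-1ℤ ℤ.^ a ℤ.* + ((a ℕ.+ n) C a))           ≈⟨ intCast-* (-1ℤ ℤ.^ a) _ ⟩
    intCast R (-1ℤ ℤ.^ a) * natCast R ((a ℕ.+ n) C a)     ≈⟨ *-congʳ (intCast-[-1]^ a) ⟩
    pow R (- 1#) a * natCast R ((a ℕ.+ n) C a) ∎

  natCast-C-pascal : ∀ n k → natCast R (n C suc k) ≈ natCast R (suc n C suc k) - natCast R (n C k)
  natCast-C-pascal n k = x≈z//y _ _ _ (begin
    natCast R (n C suc k) + natCast R (n C k)   ≈⟨ +-comm _ _ ⟩
    natCast R (n C k) + natCast R (n C suc k)   ≈⟨ natCast-+ (n C k) (n C suc k) ⟨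
    natCast R (n C k ℕ.+ n C suc k)             ≡⟨ ≡.cong (natCast R) (nCk+nC[k+1]≡[n+1]C[k+1] n k) ⟩
    natCast R (suc n C suc k) ∎)

  BinomialsVanish : ℕ → Set ℓ
  BinomialsVanish q = ∀ j → 0 ℕ.< j → j ℕ.< q → natCast R (q C j) ≈ 0#

  module _ (m : ℕ) (C[1+m]-vanish : BinomialsVanish (suc m)) where

    natCast[mCj]≈[-1]^j : ∀ j → j ℕ.< suc m → natCast R (m C j) ≈ pow R (- 1#) j
    natCast[mCj]≈[-1]^j zero    _       = +-identityʳ 1#
    natCast[mCj]≈[-1]^j (suc j) 1+j<1+m = begin
      natCast R (m C suc j)                          ≈⟨ natCast-C-pascal m j ⟩
      natCast R (suc m C suc j) - natCast R (m C j)  ≈⟨ +-cong (C[1+m]-vanish (suc j) (s≤s z≤n) 1+j<1+m)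
                                                          (-‿cong (natCast[mCj]≈[-1]^j j (ℕ.<-trans (ℕ.n<1+n j) 1+j<1+m))) ⟩
      0# - pow R (- 1#) j                            ≈⟨ +-identityˡ _ ⟩
      - pow R (- 1#) j                               ≈⟨ pow-[-1]-suc j ⟨
      pow R (- 1#) (suc j)                           ∎

    -- (-1)^j C(j+k, j) is the generalised binomial C(-1-k, j), so this says C(m-k, j) ≡ C(-1-k, j).
    natCast[[m∸k]Cj]≈[-1]^j*[j+k]Cj : ∀ k j → k ℕ.< suc m → j ℕ.< suc m →
                                      natCast R ((m ∸ k) C j) ≈ pow R (- 1#) j * natCast R ((j ℕ.+ k) C j)
    natCast[[m∸k]Cj]≈[-1]^j*[j+k]Cj zero    j       _ j<1+m = begin
      natCast R (m C j)                          ≈⟨ natCast[mCj]≈[-1]^j j j<1+m ⟩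
      pow R (- 1#) j                             ≈⟨ trans (*-congˡ (+-identityʳ 1#)) (*-identityʳ _) ⟨
      pow R (- 1#) j * natCast R 1               ≡⟨ ≡.cong (λ n → pow R (- 1#) j * natCast R n) [j+0]Cj≡1 ⟨
      pow R (- 1#) j * natCast R ((j ℕ.+ 0) C j) ∎
      where
      [j+0]Cj≡1 : (j ℕ.+ 0) C j ≡ 1
      [j+0]Cj≡1 = ≡.trans (≡.cong (_C j) (ℕ.+-identityʳ j)) (nCn≡1 j)
    natCast[[m∸k]Cj]≈[-1]^j*[j+k]Cj (suc k) zero    _ _ = sym (*-identityˡ _)
    natCast[[m∸k]Cj]≈[-1]^j*[j+k]Cj (suc k) (suc j) 1+k<1+m 1+j<1+m = begin
      natCast R (a C suc j)
        ≈⟨ natCast-C-pascal a j ⟩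
      natCast R (suc a C suc j) - natCast R (a C j)
        ≡⟨ ≡.cong (λ n → natCast R (n C suc j) - natCast R (a C j)) m∸k≡1+a ⟨
      natCast R ((m ∸ k) C suc j) - natCast R (a C j)
        ≈⟨ +-cong (natCast[[m∸k]Cj]≈[-1]^j*[j+k]Cj k (suc j) (ℕ.<-trans (ℕ.n<1+n k) 1+k<1+m) 1+j<1+m)
                  (-‿cong (natCast[[m∸k]Cj]≈[-1]^j*[j+k]Cj (suc k) j 1+k<1+m (ℕ.<-trans (ℕ.n<1+n j) 1+j<1+m))) ⟩
      pow R (- 1#) (suc j) * natCast R ((suc j ℕ.+ k) C suc j) - pow R (- 1#) j * natCast R (b C j)
        ≡⟨ ≡.cong (λ n → pow R (- 1#) (suc j) * natCast R (n C suc j) - pow R (- 1#) j * natCast R (b C j))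
                  (ℕ.+-suc j k) ⟨
      pow R (- 1#) (suc j) * natCast R (b C suc j) - pow R (- 1#) j * natCast R (b C j)
        ≈⟨ alternate (natCast R (b C suc j)) (natCast R (b C j)) ⟩
      pow R (- 1#) (suc j) * (natCast R (b C j) + natCast R (b C suc j))
        ≈⟨ *-congˡ (natCast-+ (b C j) (b C suc j)) ⟨
      pow R (- 1#) (suc j) * natCast R (b C j ℕ.+ b C suc j)
        ≡⟨ ≡.cong (λ n → pow R (- 1#) (suc j) * natCast R n) (nCk+nC[k+1]≡[n+1]C[k+1] b j) ⟩
      pow R (- 1#) (suc j) * natCast R ((suc j ℕ.+ suc k) C suc j) ∎
      where
      a b : ℕ
      a = m ∸ suc k
      b = j ℕ.+ suc k
      m∸k≡1+a : m ∸ k ≡ suc a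
      m∸k≡1+a = ℕ.+-∸-assoc 1 (ℕ.s≤s⁻¹ 1+k<1+m)
      alternate : ∀ x y → pow R (- 1#) (suc j) * x - pow R (- 1#) j * y ≈ pow R (- 1#) (suc j) * (y + x)
      alternate x y = begin
        pow R (- 1#) (suc j) * x - pow R (- 1#) j * y ≈⟨ +-congʳ (*-congʳ (pow-[-1]-suc j)) ⟩
        - pow R (- 1#) j * x - pow R (- 1#) j * y     ≈⟨ negate-sum (pow R (- 1#) j) x y ⟩
        - pow R (- 1#) j * (y + x)                    ≈⟨ *-congʳ (pow-[-1]-suc j) ⟨
        pow R (- 1#) (suc j) * (y + x)                ∎
        where
        negate-sum : ∀ s x y → - s * x - s * y ≈ - s * (y + x)
        negate-sum = solve 3 (λ s x y → :- s :* x :- s :* y := :- s :* (y :+ x)) refl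

    intCast[binomℤ[-k][1+k]]≈[1+m∸k]C[1+k] : ∀ k → suc k ℕ.< suc m →
      intCast R (binomℤ (negℤ (+ k)) (suc k)) ≈ natCast R ((suc m ∸ k) C suc k)
    intCast[binomℤ[-k][1+k]]≈[1+m∸k]C[1+k] zero    1<1+m   = sym (C[1+m]-vanish 1 (s≤s z≤n) 1<1+m)
    intCast[binomℤ[-k][1+k]]≈[1+m∸k]C[1+k] (suc k) 2+k<1+m = trans (intCast-binomℤ-negsuc k (suc (suc k)))
      (sym (natCast[[m∸k]Cj]≈[-1]^j*[j+k]Cj k (suc (suc k)) k<1+m 2+k<1+m))
      where
      k<1+m : k ℕ.< suc m
      k<1+m = ℕ.<-trans (ℕ.n<1+n k) (ℕ.<-trans (ℕ.n<1+n (suc k)) 2+k<1+m)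

  sum-binomℤ-neg≈fib′ : ∀ z {q} → 1 ℕ.< q → BinomialsVanish q →
    sumUpTo R ((q ∸ 1) / 2) (λ k → intCast R (binomℤ (negℤ (+ k)) (suc k)) * pow R z k) ≈ fib′ z q
  sum-binomℤ-neg≈fib′ z {suc m} (s≤s 0<m) C[1+m]-vanish = begin
    sumUpTo R N (λ k → intCast R (binomℤ (negℤ (+ k)) (suc k)) * pow R z k)
      ≈⟨ sumUpTo-cong N (λ k k≤N → *-congʳ
           (intCast[binomℤ[-k][1+k]]≈[1+m∸k]C[1+k] m C[1+m]-vanish k (s≤s (k≤m/2⇒k<m 0<m k≤N)))) ⟩
    sumUpTo R N g
      ≈⟨ sumUpTo-vanishing (ℕ.≤⇒≤′ N≤1+m) beyond ⟨
    fib′ z (suc m) ∎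
    where
    N : ℕ
    N = m / 2
    g : ℕ → Carrier
    g k = natCast R ((suc m ∸ k) C suc k) * pow R z k
    N≤1+m : N ℕ.≤ suc m
    N≤1+m = ℕ.≤-trans (m/n≤m m 2) (ℕ.n≤1+n m)
    beyond : ∀ k → N ℕ.< k → g k ≈ 0#
    beyond k N<k = trans (*-congʳ (reflexive (≡.cong (natCast R) (k>n⇒nCk≡0 1+m∸k<1+k)))) (zeroˡ _)
      where
      1+m∸k<1+k : suc m ∸ k ℕ.< suc k
      1+m∸k<1+k = s≤s (ℕ.m≤n+o⇒m∸n≤o (suc m) k (m/2<k⇒m<k+k N<k))

  private
    module Σ⁺ = Sum +-commutativeMonoid
    module Π = Sum *-commutativeMonoid

  module FiniteField {q : ℕ} (F : IsFiniteField R q) where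
    open IsFiniteField F
    open Inverse card public
      using (to; from; to-cong) renaming (strictlyInverseˡ to to-from; strictlyInverseʳ to from-to)

    to-injective : ∀ {x y} → to x ≡ to y → x ≈ y
    to-injective {x} {y} tx≡ty = trans (sym (from-to x)) (trans (reflexive (≡.cong from tx≡ty)) (from-to y))

    _≟_ : Decidable _≈_
    x ≟ y with to x Fin.≟ to y
    ... | yes tx≡ty = yes (to-injective tx≡ty)
    ... | no  tx≢ty = no (tx≢ty ∘ to-cong)

    *-cancelˡ-≉0 : ∀ {x y w} → x ≉ 0# → x * y ≈ x * w → y ≈ w
    *-cancelˡ-≉0 {x} {y} {w} x≉0 xy≈xw = let (x⁻¹ , xx⁻¹≈1) = inverse x x≉0 in begin
      y              ≈⟨ trans (*-congʳ xx⁻¹≈1) (*-identityˡ y) ⟨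
      x * x⁻¹ * y    ≈⟨ xy∙z≈y∙xz x x⁻¹ y ⟩
      x⁻¹ * (x * y)  ≈⟨ *-congˡ xy≈xw ⟩
      x⁻¹ * (x * w)  ≈⟨ xy∙z≈y∙xz x x⁻¹ w ⟨
      x * x⁻¹ * w    ≈⟨ trans (*-congʳ xx⁻¹≈1) (*-identityˡ w) ⟩
      w              ∎

    *-≉0 : ∀ {x y} → x ≉ 0# → y ≉ 0# → x * y ≉ 0#
    *-≉0 {x} {y} x≉0 y≉0 xy≈0 = y≉0 (*-cancelˡ-≉0 x≉0 (trans xy≈0 (sym (zeroʳ x))))

    permutation : (f g : Carrier → Carrier) →
                  (∀ {x y} → x ≈ y → f x ≈ f y) → (∀ {x y} → x ≈ y → g x ≈ g y) →
                  (∀ x → f (g x) ≈ x) → (∀ x → g (f x) ≈ x) → Perm.Permutation q q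
    permutation f g f-cong g-cong fg≈id gf≈id = Perm.permutation
      (λ i → to (f (from i))) (λ i → to (g (from i)))
      (λ i → ≡.trans (to-cong (trans (f-cong (from-to _)) (fg≈id (from i)))) (to-from i))
      (λ i → ≡.trans (to-cong (trans (g-cong (from-to _)) (gf≈id (from i)))) (to-from i))

    natCast-card≈0 : natCast R q ≈ 0#
    natCast-card≈0 = ∙-cancelˡ (Σ⁺.sum from) _ _ (begin
      Σ⁺.sum from + natCast R q                ≈⟨ +-congˡ (sum-ones q) ⟨
      Σ⁺.sum from + Σ⁺.sum {q} (λ _ → 1#)      ≈⟨ Σ⁺.∑-distrib-+ from (λ _ → 1#) ⟨
      Σ⁺.sum (λ i → from i + 1#)               ≈⟨ Σ⁺.sum-cong-≋ (λ i → from-to (from i + 1#)) ⟨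
      Σ⁺.sum (λ i → from (to (from i + 1#)))   ≈⟨ Σ⁺.sum-permute from shift ⟨
      Σ⁺.sum from                              ≈⟨ +-identityʳ _ ⟨
      Σ⁺.sum from + 0#                         ∎)
      where
      shift : Perm.Permutation q q
      shift = permutation (_+ 1#) (_- 1#) +-congʳ +-congʳ
        (//-rightDividesˡ 1#) (//-rightDividesʳ 1#)
      sum-ones : ∀ n → Σ⁺.sum {n} (λ _ → 1#) ≈ natCast R n
      sum-ones zero    = refl
      sum-ones (suc n) = +-congˡ (sum-ones n)

    Π-≉0 : ∀ {n} (t : Fin.Fin n → Carrier) → (∀ i → t i ≉ 0#) → Π.sum t ≉ 0#
    Π-≉0 {zero}  t _     = nontrivial
    Π-≉0 {suc n} t t≉0 = *-≉0 (t≉0 Fin.zero) (Π-≉0 (t ∘ Fin.suc) (t≉0 ∘ Fin.suc))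

  Π-const : ∀ n x → Π.sum {n} (λ _ → x) ≈ pow R x n
  Π-const zero    x = refl
  Π-const (suc n) x = trans (*-congˡ (Π-const n x)) (*-comm x _)

  -- Multiplication by a fixes 0, so it permutes the nonzero elements, which are enumerated by
  -- `punchIn 0ᶠ`; comparing their products gives a^(q-1) P = P with P ≠ 0.
  pow[card-1]≈1 : ∀ {q′} → IsFiniteField R (suc q′) → ∀ {a} → a ≉ 0# → pow R a q′ ≈ 1#
  pow[card-1]≈1 {q′} F {a} a≉0 = *-cancelˡ-≉0 (Π-≉0 h h≉0) (begin
      P * pow R a q′                 ≈⟨ *-comm P _ ⟩
      pow R a q′ * P                 ≈⟨ *-congʳ (Π-const q′ a) ⟨
      Π.sum {q′} (λ _ → a) * P       ≈⟨ Π.∑-distrib-+ (λ _ → a) h ⟨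
      Π.sum (λ j → a * h j)          ≈⟨ Π.sum-cong-≋ scale-h ⟨
      Π.sum (λ j → h (ρ ⟨$⟩ʳ j))     ≈⟨ Π.sum-permute h ρ ⟨
      P                              ≈⟨ *-identityʳ P ⟨
      P * 1#                         ∎)
    where
    open IsFiniteField F
    open FiniteField F
    a⁻¹ : Carrier
    a⁻¹ = proj₁ (inverse a a≉0)
    cancel : ∀ x → a * a⁻¹ * x ≈ x
    cancel x = trans (*-congʳ (proj₂ (inverse a a≉0))) (*-identityˡ x)
    0ᶠ : Fin.Fin (suc q′)
    0ᶠ = to 0#
    scale : Perm.Permutation (suc q′) (suc q′)
    scale = permutation (a *_) (a⁻¹ *_) *-congˡ *-congˡ
      (λ x → trans (sym (*-assoc a a⁻¹ x)) (cancel x))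
      (λ x → trans (sym (xy∙z≈y∙xz a a⁻¹ x)) (cancel x))
    ρ : Perm.Permutation q′ q′
    ρ = Perm.remove 0ᶠ scale
    h : Fin.Fin q′ → Carrier
    h j = from (Fin.punchIn 0ᶠ j)
    P : Carrier
    P = Π.sum h
    h≉0 : ∀ j → h j ≉ 0#
    h≉0 j h≈0 = Fin.punchInᵢ≢i 0ᶠ j (≡.trans (≡.sym (to-from _)) (to-cong h≈0))
    scale-0 : scale ⟨$⟩ʳ 0ᶠ ≡ 0ᶠ
    scale-0 = to-cong (trans (*-congˡ (from-to 0#)) (zeroʳ a))
    scale-h : ∀ j → h (ρ ⟨$⟩ʳ j) ≈ a * h j
    scale-h j = begin
      from (Fin.punchIn 0ᶠ (ρ ⟨$⟩ʳ j))                 ≡⟨ ≡.cong (λ i → from (Fin.punchIn i (ρ ⟨$⟩ʳ j))) scale-0 ⟨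
      from (Fin.punchIn (scale ⟨$⟩ʳ 0ᶠ) (ρ ⟨$⟩ʳ j))    ≡⟨ ≡.cong from (Perm.punchIn-permute scale 0ᶠ j) ⟨
      from (scale ⟨$⟩ʳ Fin.punchIn 0ᶠ j)               ≈⟨ from-to _ ⟩
      a * h j                                          ∎

  pow-card : ∀ {q} → IsFiniteField R q → ∀ x → pow R x q ≈ x
  pow-card {zero}   F x = ⊥-elim (Fin.¬Fin0 (Inverse.to (IsFiniteField.card F) x))
  pow-card {suc q′} F x with FiniteField._≟_ F x 0#
  ... | yes x≈0 = trans (*-congˡ x≈0) (trans (zeroʳ _) (sym x≈0))
  ... | no  x≉0 = trans (*-congʳ (pow[card-1]≈1 F x≉0)) (*-identityˡ x)

  1<card : ∀ {q} → IsFiniteField R q → 1 ℕ.< q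
  1<card {zero}        F = ⊥-elim (Fin.¬Fin0 (Inverse.to (IsFiniteField.card F) 0#))
  1<card {suc zero}    F = ⊥-elim (IsFiniteField.nontrivial F (FiniteField.to-injective F (Fin1-unique _ _)))
    where
    Fin1-unique : (i j : Fin.Fin 1) → i ≡ j
    Fin1-unique Fin.zero Fin.zero = ≡.refl
  1<card {suc (suc q)} F = s≤s (s≤s z≤n)

  natCast-base≈0 : ∀ m n → IsFiniteField R (m ^ suc n) → natCast R m ≈ 0#
  natCast-base≈0 m n F with natCast R m ≟ 0#
    where open FiniteField F
  ... | yes m≈0 = m≈0
  ... | no  m≉0 = ⊥-elim (natCast-^≉0 (suc n) (FiniteField.natCast-card≈0 F))
    where
    natCast-^≉0 : ∀ k → natCast R (m ^ k) ≉ 0#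
    natCast-^≉0 zero    = IsFiniteField.nontrivial F ∘ trans (sym (+-identityʳ 1#))
    natCast-^≉0 (suc k) = FiniteField.*-≉0 F m≉0 (natCast-^≉0 k) ∘ trans (sym (natCast-* m (m ^ k)))

  natCast-C-card≈0 : ∀ {p} n → Prime p → IsFiniteField R (p ^ suc n) → BinomialsVanish (p ^ suc n)
  natCast-C-card≈0 {p} n p-prime F j 0<j j<q with p∣p^mCj p-prime (suc n) 0<j j<q
  ... | divides k C≡kp = begin
    natCast R (p ^ suc n C j)     ≡⟨ ≡.cong (natCast R) C≡kp ⟩
    natCast R (k ℕ.* p)           ≈⟨ natCast-* k p ⟩
    natCast R k * natCast R p     ≈⟨ *-congˡ (natCast-base≈0 p n F) ⟩
    natCast R k * 0#              ≈⟨ zeroʳ _ ⟩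
    0#                            ∎

  fib′-card≈1 : ∀ {q z α β} → IsFiniteField R q → z ≉ 0# → α ≉ β → α * α ≈ α + z → β * β ≈ β + z →
                fib′ z q ≈ 1#
  fib′-card≈1 {q} {z} {α} {β} F z≉0 α≉β α²≈α+z β²≈β+z = begin
    fib′ z q    ≈⟨ *-cancelˡ-≉0 z≉0 (∙-cancelˡ 1# _ _ 1+z*fib′[q]≈1+z*fib′[1]) ⟩
    fib′ z 1    ≈⟨ fib′-one z ⟩
    1#          ∎
    where
    open FiniteField F
    α-β≉0 : α - β ≉ 0#
    α-β≉0 = α≉β ∘ x∙y⁻¹≈ε⇒x≈y α β
    pow-[2+q] : ∀ x → pow R x (suc (suc q)) ≈ pow R x 3
    pow-[2+q] x = *-congʳ (*-congʳ (trans (pow-card F x) (sym (*-identityˡ x))))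
    fib[1+q]≈fib[2] : fib z (suc q) ≈ fib z 2
    fib[1+q]≈fib[2] = *-cancelˡ-≉0 α-β≉0 (begin
      (α - β) * fib z (suc q)                   ≈⟨ fib-binet z α²≈α+z β²≈β+z (suc q) ⟩
      pow R α (suc (suc q)) - pow R β (suc (suc q)) ≈⟨ +-cong (pow-[2+q] α) (-‿cong (pow-[2+q] β)) ⟩
      pow R α 3 - pow R β 3                     ≈⟨ fib-binet z α²≈α+z β²≈β+z 2 ⟨
      (α - β) * fib z 2                         ∎)
    1+z*fib′[q]≈1+z*fib′[1] : 1# + z * fib′ z q ≈ 1# + z * fib′ z 1
    1+z*fib′[q]≈1+z*fib′[1] = trans (sym (fib-suc z q)) (trans fib[1+q]≈fib[2] (fib-suc z 1))

  neg-root : ∀ {r z} → (r * r + r) - z ≈ 0# → (- r) * (- r) ≈ - r + z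
  neg-root {r} {z} root = begin
    (- r) * (- r)                     ≈⟨ expand r z ⟩
    ((r * r + r) - z) + (- r + z)     ≈⟨ +-congʳ root ⟩
    0# + (- r + z)                    ≈⟨ +-identityˡ _ ⟩
    - r + z                           ∎
    where
    expand : ∀ r z → (- r) * (- r) ≈ ((r * r + r) - z) + (- r + z)
    expand = solve 2 (λ r z → (:- r) :* (:- r) := ((r :* r :+ r) :- z) :+ ((:- r) :+ z)) refl

lemma5p2 : {c ℓ : Level} (R : CommutativeRing c ℓ) (p n : ℕ) → Prime p →
  let open CommutativeRing R in
  IsFiniteField R (p ^ suc n) →
  (z : Carrier) → ¬ (z ≈ 0#) →
  (Σ[ r ∈ Carrier ] Σ[ s ∈ Carrier ] (¬ (r ≈ s) × ((r * r + r) - z ≈ 0#) × ((s * s + s) - z ≈ 0#))) →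
  sumUpTo R ((p ^ suc n ∸ 1) / 2) (λ k → intCast R (binomℤ (negℤ (+ k)) (suc k)) * pow R z k) ≈ 1#
lemma5p2 R p n p-prime F z z≉0 (r , s , r≉s , r-root , s-root) =
  trans (sum-binomℤ-neg≈fib′ R z (1<card R F) (natCast-C-card≈0 R n p-prime F))
        (fib′-card≈1 R F z≉0 (r≉s ∘ ⁻¹-injective) (neg-root R r-root) (neg-root R s-root))
  where
  open CommutativeRing R
  open import Algebra.Properties.Group +-group using (⁻¹-injective)
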